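{- For every even integer $n \ge 5$ (i.e. even $n\ge 6$), $\mathrm{eqdim}(R''_n)=3n$.
   Context: All graphs are finite, simple, connected and undirected; $d(u,v)$ denotes the number of edges of a shortest path between $u$ and $v$. A vertex $x$ is equidistant from $u$ and $v$ if $d(u,x)=d(v,x)$. A set $S\subseteq V(G)$ is a distance-equalizer set of $G$ if for every pair of distinct vertices $u,v\in V(G)\setminus S$ there is $x\in S$ equidistant from $u$ and $v$. The equidistant dimension $\mathrm{eqdim}(G)$ is the minimum cardinality of a distance-equalizer set of $G$. The graph $R''_n$ has vertex set $\{a_i,b_i,c_i,d_i,e_i,f_i : i=0,\dots,n-1\}$ and edge set $\{a_ia_{i+1}, f_if_{i+1}, a_ib_i, c_id_i, e_if_i, b_ic_i, b_{i+1}c_i, d_ie_i, d_{i+1}e_i : i=0,\dots,n-1\}$, with indices taken modulo $n$. -}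

module Defs where

open import Data.Nat using (ℕ; zero; suc; _<_; _≤_; NonZero)
open import Data.Nat.DivMod using (_%_; m%n<n)
open import Data.Fin using (Fin; toℕ; fromℕ<)
open import Data.Product using (_×_; _,_; ∃; ∃-syntax; Σ-syntax)
open import Data.Sum using (_⊎_)
open import Data.List using (List; length)
open import Data.List.Membership.Propositional using (_∈_; _∉_)
open import Data.List.Relation.Unary.Unique.Propositional using (Unique)
open import Relation.Nullary using (¬_)
open import Relation.Binary.PropositionalEquality using (_≡_; _≢_)

data Kind : Set where
  a b c d e f : Kind

V : ℕ → Set
V n = Kind × Fin n

next : ∀ {n} → Fin n → Fin n
next {suc m} i = fromℕ< (m%n<n (suc (toℕ i)) (suc m))

data Edge {n : ℕ} : V n → V n → Set where
  aa : ∀ i → Edge (a , i) (a , next i)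
  ff : ∀ i → Edge (f , i) (f , next i)
  ab : ∀ i → Edge (a , i) (b , i)
  cd : ∀ i → Edge (c , i) (d , i)
  ef : ∀ i → Edge (e , i) (f , i)
  bc : ∀ i → Edge (b , i) (c , i)
  b'c : ∀ i → Edge (b , next i) (c , i)
  de : ∀ i → Edge (d , i) (e , i)
  d'e : ∀ i → Edge (d , next i) (e , i)

Adj : ∀ {n} → V n → V n → Set
Adj u v = Edge u v ⊎ Edge v u

data Walk {n : ℕ} : V n → V n → ℕ → Set where
  here : ∀ {u} → Walk u u 0
  step : ∀ {u w v k} → Adj u w → Walk w v k → Walk u v (suc k)

Dist : ∀ {n} → V n → V n → ℕ → Set
Dist u v k = Walk u v k × (∀ m → m < k → ¬ Walk u v m)

Equidistant : ∀ {n} → V n → V n → V n → Set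
Equidistant u v x = ∃[ k ] (Dist u x k × Dist v x k)

DistanceEqualizer : ∀ {n} → List (V n) → Set
DistanceEqualizer {n} S =
  ∀ (u v : V n) → u ≢ v → u ∉ S → v ∉ S → ∃[ x ] (x ∈ S × Equidistant u v x)

EqDim : (n k : ℕ) → Set
EqDim n k =
  (∃[ S ] (Unique S × length S ≡ k × DistanceEqualizer {n} S))
  × (∀ (S : List (V n)) → Unique S → DistanceEqualizer S → k ≤ length S)

{-# OPTIONS --safe #-}
module Submission where

-- Lift R''ₙ to the infinite ladder on the rows a, …, f indexed by ℤ. There the
-- distance from kᵢ to k'ᵢ₊ₜ is an eventually linear function of t, given by a
-- finite table, and in R''ₙ the distance is the smaller of its values for the
-- two ways around the cycle. That this formula is the graph distance follows
-- from two local facts, both checked by evaluating the tables on their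
-- prefixes and on their linear tails: it changes by at most one along an
-- edge, and every vertex other than the target has a strictly closer
-- neighbour.
--
-- Lower bound: of each of the 3n disjoint pairs {aᵢ₊₁, fᵢ}, {bᵢ₊₁, eᵢ},
-- {cᵢ, dᵢ} one member is strictly closer than the other to any given vertex,
-- so every distance-equalizer contains a member of each pair.
--
-- Upper bound: S = {dᵢ, eᵢ, fᵢ} works. For two vertices in rows a, b, c at
-- offset t ≤ n/2 an equidistant vertex of S is placed between them, beyond
-- them, or on the far side of the cycle; its row and position depend on the
-- two rows and on t, with one arithmetic family for each parity of t and
-- finitely many exceptions for small t.

open import Data.Bool using (Bool; T; true; _∧_)
open import Data.Bool.Properties using (T-∧)
open import Data.Empty using (⊥-elim)
open import Data.Fin as Fin using (Fin; zero; suc; toℕ; fromℕ<; remQuot; combine)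
open import Data.Fin.Properties using (toℕ<n; toℕ-fromℕ<; toℕ-injective; all?; injective⇒≤; combine-remQuot)
open import Data.List as List using (List; []; _∷_; null; length; cartesianProduct; allFin)
open import Data.List.Membership.DecPropositional using (_∈?_)
open import Data.List.Membership.Propositional using (_∈_; _∉_)
open import Data.List.Membership.Propositional.Properties using (∈-cartesianProduct⁺; ∈-allFin)
open import Data.List.Properties using (length-++; length-map; length-tabulate)
open import Data.List.Relation.Unary.All using ([]; _∷_)
open import Data.List.Relation.Unary.AllPairs using ([]; _∷_)
open import Data.List.Relation.Unary.Any using (here; there; index)
open import Data.List.Relation.Unary.Any.Properties using (lookup-index)
open import Data.List.Relation.Unary.Unique.Propositional using (Unique)
open import Data.List.Relation.Unary.Unique.Propositional.Properties using (cartesianProduct⁺; allFin⁺)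
open import Data.Nat
open import Data.Nat.DivMod
open import Data.Nat.Divisibility using (_∣_; divides)
open import Data.Nat.Properties
open import Data.Nat.Solver using (module +-*-Solver)
open import Data.Product using (_,_; _×_; ∃-syntax; proj₁; proj₂; uncurry)
open import Data.Product.Properties using (≡-dec)
open import Data.Sum using (_⊎_; inj₁; inj₂; swap)
open import Data.Vec using (Vec; []; _∷_; map; foldr′)
open import Data.Vec.Membership.Propositional using () renaming (_∈_ to _∈ᵥ_)
open import Data.Vec.Membership.Propositional.Properties using (fromAny)
open import Data.Vec.Relation.Unary.All as All using (All)
open import Data.Vec.Relation.Unary.Any as Any using (Any; here; there; any?)
open import Data.Vec.Relation.Unary.Any.Properties using (map⁺; map⁻)
open import Function using (_∘_; Equivalence)
open import Relation.Binary.PropositionalEquality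
open import Relation.Nullary using (Dec; yes; no; _×-dec_; _⊎-dec_; _→-dec_; contradiction)
open import Relation.Nullary.Decidable using (True; T?; isYes; toWitness; from-yes; map′; ¬?)
open import Defs
open +-*-Solver using (solve; _:+_; _:*_; _:=_; con)

variable m : ℕ

-- Eventually linear sequences

record EventuallyLinear : Set where
  constructor _▹_
  field
    prefix : List ℕ
    base   : ℕ

open EventuallyLinear

infix 4 _▹_

⟦_⟧ : EventuallyLinear → ℕ → ℕ
⟦ [] ▹ b₀ ⟧ t = t + b₀
⟦ x ∷ xs ▹ b₀ ⟧ zero = x
⟦ x ∷ xs ▹ b₀ ⟧ (suc t) = ⟦ xs ▹ b₀ ⟧ t

tail : EventuallyLinear → EventuallyLinear
tail ([] ▹ b₀) = [] ▹ suc b₀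
tail (x ∷ xs ▹ b₀) = xs ▹ b₀

⟦tail⟧ : ∀ φ t → ⟦ tail φ ⟧ t ≡ ⟦ φ ⟧ (suc t)
⟦tail⟧ ([] ▹ b₀) t = +-suc t b₀
⟦tail⟧ (x ∷ xs ▹ b₀) t = refl

drop : ℕ → EventuallyLinear → EventuallyLinear
drop zero φ = φ
drop (suc k) φ = drop k (tail φ)

⟦drop⟧ : ∀ k φ t → ⟦ drop k φ ⟧ t ≡ ⟦ φ ⟧ (k + t)
⟦drop⟧ zero φ t = refl
⟦drop⟧ (suc k) φ t = trans (⟦drop⟧ k (tail φ) t) (⟦tail⟧ φ (k + t))

infixr 3 _◃_

_◃_ : ℕ → EventuallyLinear → EventuallyLinear
x ◃ xs ▹ b₀ = x ∷ xs ▹ b₀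

_at_ : ∀ {k} → Vec EventuallyLinear k → ℕ → Vec ℕ k
φs at t = map (λ φ → ⟦ φ ⟧ t) φs

at-tail : ∀ {k} (φs : Vec EventuallyLinear k) t → map tail φs at t ≡ φs at suc t
at-tail [] t = refl
at-tail (φ ∷ φs) t = cong₂ _∷_ (⟦tail⟧ φ t) (at-tail φs t)

allLinear : ∀ {k} → Vec EventuallyLinear k → Bool
allLinear [] = true
allLinear (φ ∷ φs) = null (prefix φ) ∧ allLinear φs

at-allLinear : ∀ {k} (φs : Vec EventuallyLinear k) → T (allLinear φs) → ∀ t → φs at t ≡ map (t +_) (φs at 0)
at-allLinear [] _ t = refl
at-allLinear (([] ▹ b₀) ∷ φs) lin t = cong (t + b₀ ∷_) (at-allLinear φs lin t)

longestPrefix : ∀ {k} → Vec EventuallyLinear k → ℕ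
longestPrefix = foldr′ (λ φ → length (prefix φ) ⊔_) 0

-- A decidable property of tuples of values. On the linear tails all values
-- grow in lockstep, so there HoldsUniformly, which must imply Holds at every
-- translate, is checked just once.
record PointwiseProperty (k : ℕ) : Set₁ where
  field
    Holds            : Vec ℕ k → Set
    holds?           : ∀ xs → Dec (Holds xs)
    HoldsUniformly   : Vec ℕ k → Set
    holdsUniformly?  : ∀ xs → Dec (HoldsUniformly xs)
    uniformly        : ∀ t {xs} → HoldsUniformly xs → Holds (map (t +_) xs)

module _ {k} (P : PointwiseProperty k) where
  open PointwiseProperty P

  holdsUpTo : ℕ → Vec EventuallyLinear k → Bool
  holdsUpTo zero φs = allLinear φs ∧ isYes (holdsUniformly? (φs at 0))
  holdsUpTo (suc fuel) φs = isYes (holds? (φs at 0)) ∧ holdsUpTo fuel (map tail φs)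

  holdsUpTo-sound : ∀ fuel φs → T (holdsUpTo fuel φs) → ∀ t → Holds (φs at t)
  holdsUpTo-sound zero φs chk t with Equivalence.to T-∧ chk
  ... | lin , unif = subst Holds (sym (at-allLinear φs lin t)) (uniformly t (toWitness {a? = holdsUniformly? (φs at 0)} unif))
  holdsUpTo-sound (suc fuel) φs chk zero = toWitness {a? = holds? (φs at 0)} (proj₁ (Equivalence.to T-∧ chk))
  holdsUpTo-sound (suc fuel) φs chk (suc t) =
    subst Holds (at-tail φs t) (holdsUpTo-sound fuel (map tail φs) (proj₂ (Equivalence.to T-∧ chk)) t)

  -- After the longest prefix all the sequences are linear.
  record HoldsEverywhere (φs : Vec EventuallyLinear k) : Set where
    constructor evaluated
    field
      check : T (holdsUpTo (longestPrefix φs) φs)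

  holdsEverywhere? : ∀ φs → Dec (HoldsEverywhere φs)
  holdsEverywhere? φs = map′ evaluated HoldsEverywhere.check (T? _)

  holdsEverywhere : ∀ {φs} → HoldsEverywhere φs → ∀ t → Holds (φs at t)
  holdsEverywhere {φs} (evaluated chk) = holdsUpTo-sound (longestPrefix φs) φs chk

LessOrEqualUpTo : ℕ → ℕ → PointwiseProperty 2
LessOrEqualUpTo c₁ c₂ = record
  { Holds = Holds ; holds? = holds? ; HoldsUniformly = Holds ; holdsUniformly? = holds? ; uniformly = uniformly }
  where
  Holds : Vec ℕ 2 → Set
  Holds (x ∷ y ∷ []) = x + c₁ ≤ y + c₂
  holds? : ∀ xs → Dec (Holds xs)
  holds? (x ∷ y ∷ []) = x + c₁ ≤? y + c₂
  uniformly : ∀ t {xs} → Holds xs → Holds (map (t +_) xs)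
  uniformly t {x ∷ y ∷ []} x+c₁≤y+c₂ = begin
    t + x + c₁   ≡⟨ +-assoc t x c₁ ⟩
    t + (x + c₁) ≤⟨ +-monoʳ-≤ t x+c₁≤y+c₂ ⟩
    t + (y + c₂) ≡⟨ +-assoc t y c₂ ⟨
    t + y + c₂   ∎
    where open ≤-Reasoning

record _⊕_≤ₑ_⊕_ (φ : EventuallyLinear) (c₁ : ℕ) (ψ : EventuallyLinear) (c₂ : ℕ) : Set where
  constructor pointwise
  field
    holds : HoldsEverywhere (LessOrEqualUpTo c₁ c₂) (φ ∷ ψ ∷ [])

≤ₑ? : ∀ φ c₁ ψ c₂ → Dec (φ ⊕ c₁ ≤ₑ ψ ⊕ c₂)
≤ₑ? φ c₁ ψ c₂ = map′ pointwise _⊕_≤ₑ_⊕_.holds (holdsEverywhere? (LessOrEqualUpTo c₁ c₂) (φ ∷ ψ ∷ []))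

≤ₑ-sound : ∀ {φ c₁ ψ c₂} → φ ⊕ c₁ ≤ₑ ψ ⊕ c₂ → ∀ t → ⟦ φ ⟧ t + c₁ ≤ ⟦ ψ ⟧ t + c₂
≤ₑ-sound {c₁ = c₁} {c₂ = c₂} (pointwise φ≤ψ) = holdsEverywhere (LessOrEqualUpTo c₁ c₂) φ≤ψ

≤ₑ-sound₀ : ∀ {φ ψ} → φ ⊕ 0 ≤ₑ ψ ⊕ 0 → ∀ t → ⟦ φ ⟧ t ≤ ⟦ ψ ⟧ t
≤ₑ-sound₀ {φ} {ψ} φ≤ψ t = subst₂ _≤_ (+-identityʳ (⟦ φ ⟧ t)) (+-identityʳ (⟦ ψ ⟧ t)) (≤ₑ-sound φ≤ψ t)

≤ₑ-monotone : ∀ {φ} → φ ⊕ 0 ≤ₑ tail φ ⊕ 0 → ∀ {x y} → x ≤ y → ⟦ φ ⟧ x ≤ ⟦ φ ⟧ y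
≤ₑ-monotone {φ} φ≤tailφ {x} x≤y with m≤n⇒∃[o]m+o≡n x≤y
... | o , refl = go o
  where
  go : ∀ o → ⟦ φ ⟧ x ≤ ⟦ φ ⟧ (x + o)
  go zero = ≤-reflexive (cong ⟦ φ ⟧ (sym (+-identityʳ x)))
  go (suc o) = begin
    ⟦ φ ⟧ x             ≤⟨ go o ⟩
    ⟦ φ ⟧ (x + o)       ≤⟨ ≤ₑ-sound₀ φ≤tailφ (x + o) ⟩
    ⟦ tail φ ⟧ (x + o)  ≡⟨ ⟦tail⟧ φ (x + o) ⟩
    ⟦ φ ⟧ (suc (x + o)) ≡⟨ cong ⟦ φ ⟧ (+-suc x o) ⟨
    ⟦ φ ⟧ (x + suc o)   ∎
    where open ≤-Reasoning

⊓-+-mono : ∀ x y x' y' {c₁ c₂} → x + c₁ ≤ x' + c₂ → y + c₁ ≤ y' + c₂ → x ⊓ y + c₁ ≤ x' ⊓ y' + c₂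
⊓-+-mono x y x' y' {c₁} {c₂} p q = begin
  x ⊓ y + c₁           ≡⟨ +-distribʳ-⊓ c₁ x y ⟩
  (x + c₁) ⊓ (y + c₁)   ≤⟨ ⊓-mono-≤ p q ⟩
  (x' + c₂) ⊓ (y' + c₂) ≡⟨ +-distribʳ-⊓ c₂ x' y' ⟨
  x' ⊓ y' + c₂         ∎
  where open ≤-Reasoning

⊓ₑ-mono : ∀ {φ₁ ψ₁ φ₂ ψ₂ c₁ c₂} → φ₁ ⊕ c₁ ≤ₑ φ₂ ⊕ c₂ → ψ₁ ⊕ c₁ ≤ₑ ψ₂ ⊕ c₂ →
          ∀ x y → ⟦ φ₁ ⟧ x ⊓ ⟦ ψ₁ ⟧ y + c₁ ≤ ⟦ φ₂ ⟧ x ⊓ ⟦ ψ₂ ⟧ y + c₂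
⊓ₑ-mono {φ₁} {ψ₁} {φ₂} {ψ₂} φ≤ ψ≤ x y =
  ⊓-+-mono (⟦ φ₁ ⟧ x) (⟦ ψ₁ ⟧ y) (⟦ φ₂ ⟧ x) (⟦ ψ₂ ⟧ y) (≤ₑ-sound φ≤ x) (≤ₑ-sound ψ≤ y)

_≡ₑ_ : EventuallyLinear → EventuallyLinear → Set
φ ≡ₑ ψ = φ ⊕ 0 ≤ₑ ψ ⊕ 0 × ψ ⊕ 0 ≤ₑ φ ⊕ 0

≡ₑ-sound : ∀ {φ ψ} → φ ≡ₑ ψ → ∀ t → ⟦ φ ⟧ t ≡ ⟦ ψ ⟧ t
≡ₑ-sound (φ≤ψ , ψ≤φ) t = ≤-antisym (≤ₑ-sound₀ φ≤ψ t) (≤ₑ-sound₀ ψ≤φ t)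

drop-≡ₑ⇒≡ : ∀ {φ ψ} x y z → drop (z + x) φ ≡ₑ drop (z + y) ψ →
             ∀ s → z ≤ s → ⟦ φ ⟧ (x + s) ≡ ⟦ ψ ⟧ (y + s)
drop-≡ₑ⇒≡ {φ} {ψ} x y z agree s z≤s with m≤n⇒∃[o]m+o≡n z≤s
... | o , refl = begin
  ⟦ φ ⟧ (x + (z + o))     ≡⟨ cong ⟦ φ ⟧ (shuffle x) ⟩
  ⟦ φ ⟧ (z + x + o)       ≡⟨ ⟦drop⟧ (z + x) φ o ⟨
  ⟦ drop (z + x) φ ⟧ o    ≡⟨ ≡ₑ-sound agree o ⟩
  ⟦ drop (z + y) ψ ⟧ o    ≡⟨ ⟦drop⟧ (z + y) ψ o ⟩
  ⟦ ψ ⟧ (z + y + o)       ≡⟨ cong ⟦ ψ ⟧ (shuffle y) ⟨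
  ⟦ ψ ⟧ (y + (z + o))     ∎
  where
  open ≡-Reasoning
  shuffle : ∀ w → w + (z + o) ≡ z + w + o
  shuffle w = solve 3 (λ w z o → w :+ (z :+ o) := z :+ w :+ o) refl w z o

-- Offsets on the cycle

module _ (n : ℕ) .{{_ : NonZero n}} where

  %-absorbˡ : ∀ x k → (x % n + k) % n ≡ (x + k) % n
  %-absorbˡ x k = begin
    (x % n + k) % n         ≡⟨ %-distribˡ-+ (x % n) k n ⟩
    (x % n % n + k % n) % n ≡⟨ cong (λ y → (y + k % n) % n) (m%n%n≡m%n x n) ⟩
    (x % n + k % n) % n     ≡⟨ %-distribˡ-+ x k n ⟨
    (x + k) % n             ∎
    where open ≡-Reasoning

  %-absorbʳ : ∀ k x → (k + x % n) % n ≡ (k + x) % n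
  %-absorbʳ k x = begin
    (k + x % n) % n ≡⟨ cong (_% n) (+-comm k (x % n)) ⟩
    (x % n + k) % n ≡⟨ %-absorbˡ x k ⟩
    (x + k) % n     ≡⟨ cong (_% n) (+-comm x k) ⟩
    (k + x) % n     ∎
    where open ≡-Reasoning

  %-injective : ∀ {x y} → x < n → y < n → x % n ≡ y % n → x ≡ y
  %-injective {x} {y} x<n y<n eq = begin
    x     ≡⟨ m<n⇒m%n≡m x<n ⟨
    x % n ≡⟨ eq ⟩
    y % n ≡⟨ m<n⇒m%n≡m y<n ⟩
    y     ∎
    where open ≡-Reasoning

+-cancelˡ-% : ∀ m l {x y} → (l + x) % suc m ≡ (l + y) % suc m → x % suc m ≡ y % suc m
+-cancelˡ-% m l {x} {y} eq = begin
  x % suc m                   ≡⟨ unshift x ⟩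
  ((l + x) % suc m + l * m) % suc m ≡⟨ cong (λ z → (z + l * m) % suc m) eq ⟩
  ((l + y) % suc m + l * m) % suc m ≡⟨ unshift y ⟨
  y % suc m                   ∎
  where
  open ≡-Reasoning
  unshift : ∀ z → z % suc m ≡ ((l + z) % suc m + l * m) % suc m
  unshift z = begin
    z % suc m                         ≡⟨ [m+kn]%n≡m%n z l (suc m) ⟨
    (z + l * suc m) % suc m           ≡⟨ cong (_% suc m) (solve 3 (λ z l m →
                                            z :+ l :* (con 1 :+ m) := (l :+ z) :+ l :* m) refl z l m) ⟩
    ((l + z) + l * m) % suc m         ≡⟨ %-absorbˡ (suc m) (l + z) (l * m) ⟨
    ((l + z) % suc m + l * m) % suc m ∎


opaque
  offset : Fin (suc m) → Fin (suc m) → ℕ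
  offset {m} i j = (toℕ j + (suc m ∸ toℕ i)) % suc m

  offset<n : (i j : Fin (suc m)) → offset i j < suc m
  offset<n {m} i j = m%n<n (toℕ j + (suc m ∸ toℕ i)) (suc m)

  offset-spec : (i j : Fin (suc m)) → (toℕ i + offset i j) % suc m ≡ toℕ j
  offset-spec {m} i j = begin
    (toℕ i + (toℕ j + (suc m ∸ toℕ i)) % suc m) % suc m ≡⟨ %-absorbʳ (suc m) (toℕ i) _ ⟩
    (toℕ i + (toℕ j + (suc m ∸ toℕ i))) % suc m         ≡⟨ cong (_% suc m) go-around ⟩
    (toℕ j + suc m) % suc m                             ≡⟨ [m+n]%n≡m%n (toℕ j) (suc m) ⟩
    toℕ j % suc m                                       ≡⟨ m<n⇒m%n≡m (toℕ<n j) ⟩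
    toℕ j                                               ∎
    where
    open ≡-Reasoning
    go-around : toℕ i + (toℕ j + (suc m ∸ toℕ i)) ≡ toℕ j + suc m
    go-around = begin
      toℕ i + (toℕ j + (suc m ∸ toℕ i)) ≡⟨ +-assoc (toℕ i) (toℕ j) _ ⟨
      toℕ i + toℕ j + (suc m ∸ toℕ i)   ≡⟨ cong (_+ (suc m ∸ toℕ i)) (+-comm (toℕ i) (toℕ j)) ⟩
      toℕ j + toℕ i + (suc m ∸ toℕ i)   ≡⟨ +-assoc (toℕ j) (toℕ i) _ ⟩
      toℕ j + (toℕ i + (suc m ∸ toℕ i)) ≡⟨ cong (toℕ j +_) (m+[n∸m]≡n (<⇒≤ (toℕ<n i))) ⟩
      toℕ j + suc m                     ∎

offset-unique : (i j : Fin (suc m)) {s : ℕ} → s < suc m → (toℕ i + s) % suc m ≡ toℕ j → offset i j ≡ s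
offset-unique {m} i j s<n eq =
  %-injective (suc m) (offset<n i j) s<n (+-cancelˡ-% m (toℕ i) (trans (offset-spec i j) (sym eq)))

toℕ≡[toℕ+0]% : (i : Fin (suc m)) → toℕ i ≡ (toℕ i + 0) % suc m
toℕ≡[toℕ+0]% i = sym (trans (cong (_% _) (+-identityʳ (toℕ i))) (m<n⇒m%n≡m (toℕ<n i)))

offset-self : (i : Fin (suc m)) → offset i i ≡ 0
offset-self i = offset-unique i i z<s (sym (toℕ≡[toℕ+0]% i))

offset≡0⇒≡ : {i j : Fin (suc m)} → offset i j ≡ 0 → i ≡ j
offset≡0⇒≡ {i = i} {j} eq =
  toℕ-injective (trans (toℕ≡[toℕ+0]% i) (trans (cong (λ s → (toℕ i + s) % _) (sym eq)) (offset-spec i j)))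

∃-offset : (i : Fin (suc m)) {s : ℕ} → s < suc m → ∃[ l ] offset i l ≡ s
∃-offset {m} i {s} s<n = l , offset-unique i l s<n (sym (toℕ-fromℕ< (m%n<n (toℕ i + s) (suc m))))
  where l = fromℕ< (m%n<n (toℕ i + s) (suc m))

offset-compose : {i j l : Fin (suc m)} {t p q : ℕ} → offset i j ≡ t → offset i l ≡ p → q < suc m →
                 (t + q) % suc m ≡ p % suc m → offset j l ≡ q
offset-compose {m} {i} {j} {l} {t} {p} {q} refl refl q<n t+q≡p = offset-unique j l q<n (begin
  (toℕ j + q) % N                  ≡⟨ cong (λ z → (z + q) % N) (offset-spec i j) ⟨
  ((toℕ i + t) % N + q) % N        ≡⟨ %-absorbˡ N (toℕ i + t) q ⟩
  (toℕ i + t + q) % N              ≡⟨ cong (_% N) (+-assoc (toℕ i) t q) ⟩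
  (toℕ i + (t + q)) % N            ≡⟨ %-absorbʳ N (toℕ i) (t + q) ⟨
  (toℕ i + (t + q) % N) % N        ≡⟨ cong (λ z → (toℕ i + z) % N) t+q≡p ⟩
  (toℕ i + p % N) % N              ≡⟨ %-absorbʳ N (toℕ i) p ⟩
  (toℕ i + p) % N                  ≡⟨ offset-spec i l ⟩
  toℕ l                            ∎)
  where
  N = suc m
  open ≡-Reasoning

predMod : ℕ → ℕ → ℕ
predMod m zero = m
predMod m (suc s) = s

toℕ-next : (i : Fin (suc m)) → toℕ (next i) ≡ suc (toℕ i) % suc m
toℕ-next {m} i = toℕ-fromℕ< (m%n<n (suc (toℕ i)) (suc m))

offset-next : (i j : Fin (suc m)) → offset (next i) j ≡ predMod m (offset i j)
offset-next {m} i j = offset-unique (next i) j (predMod<n (offset i j) (offset<n i j)) (begin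
  (toℕ (next i) + p) % N          ≡⟨ cong (λ z → (z + p) % N) (toℕ-next i) ⟩
  (suc (toℕ i) % N + p) % N       ≡⟨ %-absorbˡ N (suc (toℕ i)) p ⟩
  suc (toℕ i + p) % N             ≡⟨ cong (_% N) (+-suc (toℕ i) p) ⟨
  (toℕ i + suc p) % N             ≡⟨ around (offset i j) ⟩
  (toℕ i + offset i j) % N        ≡⟨ offset-spec i j ⟩
  toℕ j                           ∎)
  where
  N = suc m
  p = predMod m (offset i j)
  open ≡-Reasoning
  predMod<n : ∀ r → r < N → predMod m r < N
  predMod<n zero _ = n<1+n m
  predMod<n (suc s) r<n = <-trans (n<1+n s) r<n
  around : ∀ r → (toℕ i + suc (predMod m r)) % N ≡ (toℕ i + r) % N
  around zero = trans ([m+n]%n≡m%n (toℕ i) N) (cong (_% N) (sym (+-identityʳ (toℕ i))))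
  around (suc s) = refl

prev : Fin (suc m) → Fin (suc m)
prev {m} i = fromℕ< (m%n<n (toℕ i + m) (suc m))

next-prev : (i : Fin (suc m)) → next (prev i) ≡ i
next-prev {m} i = toℕ-injective (begin
  toℕ (next (prev i))           ≡⟨ toℕ-next (prev i) ⟩
  suc (toℕ (prev i)) % N        ≡⟨ cong (λ z → suc z % N) (toℕ-fromℕ< (m%n<n (toℕ i + m) N)) ⟩
  (1 + (toℕ i + m) % N) % N     ≡⟨ %-absorbʳ N 1 (toℕ i + m) ⟩
  suc (toℕ i + m) % N           ≡⟨ cong (_% N) (+-suc (toℕ i) m) ⟨
  (toℕ i + N) % N               ≡⟨ [m+n]%n≡m%n (toℕ i) N ⟩
  toℕ i % N                     ≡⟨ m<n⇒m%n≡m (toℕ<n i) ⟩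
  toℕ i                         ∎)
  where
  N = suc m
  open ≡-Reasoning

next-injective : {i j : Fin (suc m)} → next i ≡ next j → i ≡ j
next-injective {m} {i} {j} eq = toℕ-injective (%-injective (suc m) (toℕ<n i) (toℕ<n j)
  (+-cancelˡ-% m 1 (trans (sym (toℕ-next i)) (trans (cong toℕ eq) (toℕ-next j)))))

-- The distance in R''ₙ

every-kind : {P : Kind → Set} → P a → P b → P c → P d → P e → P f → ∀ k → P k
every-kind pa pb pc pd pe pf a = pa
every-kind pa pb pc pd pe pf b = pb
every-kind pa pb pc pd pe pf c = pc
every-kind pa pb pc pd pe pf d = pd
every-kind pa pb pc pd pe pf e = pe
every-kind pa pb pc pd pe pf f = pf

∀-kind? : {P : Kind → Set} → (∀ k → Dec (P k)) → Dec (∀ k → P k)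
∀-kind? P? = map′ (λ (pa , pb , pc , pd , pe , pf) → every-kind pa pb pc pd pe pf)
                  (λ all → all a , all b , all c , all d , all e , all f)
                  (P? a ×-dec P? b ×-dec P? c ×-dec P? d ×-dec P? e ×-dec P? f)

kindIndex : Kind → ℕ
kindIndex a = 0
kindIndex b = 1
kindIndex c = 2
kindIndex d = 3
kindIndex e = 4
kindIndex f = 5

kindAt : ℕ → Kind
kindAt 0 = a
kindAt 1 = b
kindAt 2 = c
kindAt 3 = d
kindAt 4 = e
kindAt _ = f

kindAt-kindIndex : ∀ k → kindAt (kindIndex k) ≡ k
kindAt-kindIndex = every-kind refl refl refl refl refl refl

_≟ₖ_ : (k k' : Kind) → Dec (k ≡ k')
k ≟ₖ k' = map′ (λ eq → trans (sym (kindAt-kindIndex k)) (trans (cong kindAt eq) (kindAt-kindIndex k')))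
               (cong kindIndex) (kindIndex k ≟ kindIndex k')

-- forward k k' t is the distance from kᵢ to k'ᵢ₊ₜ in the two-way infinite
-- ladder covering R''ₙ.
forward : Kind → Kind → EventuallyLinear
forward a a = [] ▹ 0
forward a b = [] ▹ 1
forward a c = [] ▹ 2
forward a d = [] ▹ 3
forward a e = [] ▹ 4
forward a f = [] ▹ 5
forward b a = [] ▹ 1
forward b b = 0 ∷ 2 ∷ [] ▹ 4
forward b c = 1 ∷ 3 ∷ [] ▹ 5
forward b d = 2 ∷ 4 ∷ [] ▹ 6
forward b e = 3 ∷ 5 ∷ [] ▹ 7
forward b f = [] ▹ 4
forward c a = 2 ∷ [] ▹ 2
forward c b = 1 ∷ 1 ∷ 3 ∷ [] ▹ 5
forward c c = 0 ∷ 2 ∷ 4 ∷ [] ▹ 6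
forward c d = 1 ∷ 3 ∷ 5 ∷ [] ▹ 7
forward c e = 2 ∷ 4 ∷ [] ▹ 6
forward c f = [] ▹ 3
forward d a = 3 ∷ [] ▹ 3
forward d b = 2 ∷ 2 ∷ 4 ∷ [] ▹ 6
forward d c = 1 ∷ 3 ∷ 5 ∷ [] ▹ 7
forward d d = 0 ∷ 2 ∷ 4 ∷ [] ▹ 6
forward d e = 1 ∷ 3 ∷ [] ▹ 5
forward d f = [] ▹ 2
forward e a = 4 ∷ 4 ∷ [] ▹ 4
forward e b = 3 ∷ 3 ∷ 3 ∷ 5 ∷ [] ▹ 7
forward e c = 2 ∷ 2 ∷ 4 ∷ [] ▹ 6
forward e d = 1 ∷ 1 ∷ 3 ∷ [] ▹ 5
forward e e = 0 ∷ 2 ∷ [] ▹ 4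
forward e f = [] ▹ 1
forward f a = 5 ∷ 5 ∷ [] ▹ 5
forward f b = 4 ∷ 4 ∷ [] ▹ 4
forward f c = 3 ∷ [] ▹ 3
forward f d = 2 ∷ [] ▹ 2
forward f e = [] ▹ 1
forward f f = [] ▹ 0

-- In the ladder d(kᵢ, k'ᵢ₋ₜ) = d(k'ᵢ, kᵢ₊ₜ).
backward : Kind → Kind → EventuallyLinear
backward k k' = forward k' k

-- Lifted to the ladder, a shortest path from kᵢ to k'ⱼ ends at the nearest lift
-- of k'ⱼ forwards (r steps) or backwards (n ∸ r steps), r the offset of j from i.
δₒ : ℕ → Kind → Kind → ℕ → ℕ
δₒ m k k' r = ⟦ forward k k' ⟧ r ⊓ ⟦ backward k k' ⟧ (suc m ∸ r)

δ : V (suc m) → V (suc m) → ℕ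
δ {m} (k , i) (k' , j) = δₒ m k k' (offset i j)

data Step : Set where
  stay ahead behind : Step

_⟶[_]_ : Fin (suc m) → Step → Fin (suc m) → Set
i ⟶[ stay ] i' = i' ≡ i
i ⟶[ ahead ] i' = i' ≡ next i
i ⟶[ behind ] i' = next i' ≡ i

move : ∀ s (i : Fin (suc m)) → ∃[ i' ] i ⟶[ s ] i'
move stay i = i , refl
move ahead i = next i , refl
move behind i = prev i , next-prev i

-- Bounds on δ from a source moved by one step, in terms of the offset r of
-- the target from the unmoved source: the first sequence is read at r, the
-- second at m ∸ r.
forwardVia : Step → Kind → Kind → EventuallyLinear
forwardVia stay k k' = forward k k'
forwardVia ahead k k' = ⟦ backward k k' ⟧ 1 ◃ forward k k'
forwardVia behind k k' = tail (forward k k')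

backwardVia : Step → Kind → Kind → EventuallyLinear
backwardVia stay k k' = tail (backward k k')
backwardVia ahead k k' = drop 2 (backward k k')
backwardVia behind k k' = ⟦ forward k k' ⟧ 0 ◃ tail (backward k k')

via : ℕ → Step → Kind → Kind → ℕ → ℕ
via m s k k' r = ⟦ forwardVia s k k' ⟧ r ⊓ ⟦ backwardVia s k k' ⟧ (m ∸ r)

forward-monotone : ∀ k k' → forward k k' ⊕ 0 ≤ₑ tail (forward k k') ⊕ 0
forward-monotone = from-yes (∀-kind? λ k → ∀-kind? λ k' → ≤ₑ? (forward k k') 0 (tail (forward k k')) 0)

⟦forward⟧-mono : ∀ k k' {x y} → x ≤ y → ⟦ forward k k' ⟧ x ≤ ⟦ forward k k' ⟧ y
⟦forward⟧-mono k k' = ≤ₑ-monotone (forward-monotone k k')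

∸-suc : ∀ {m n} → n < m → m ∸ n ≡ suc (m ∸ suc n)
∸-suc (s≤s n≤m) = +-∸-assoc 1 n≤m

δₒ-stay : ∀ k k' {r} → r < suc m → δₒ m k k' r ≡ via m stay k k' r
δₒ-stay {m} k k' {r} r<n = cong (⟦ forward k k' ⟧ r ⊓_)
  (trans (cong ⟦ backward k k' ⟧ (∸-suc r<n)) (sym (⟦tail⟧ (backward k k') (m ∸ r))))

module _ {m : ℕ} (k k' : Kind) where
  private
    F = ⟦ forward k k' ⟧
    B = ⟦ backward k k' ⟧
    B⁺ = ⟦ ⟦ forward k k' ⟧ 0 ◃ tail (backward k k') ⟧

  δₒ-ahead : ∀ r → r < suc m → δₒ m k k' (predMod m r) ≤ via m ahead k k' r
  δₒ-ahead zero _ = ⊓-glb (begin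
      F m ⊓ B (suc m ∸ m)          ≤⟨ m⊓n≤n _ _ ⟩
      B (suc m ∸ m)                ≡⟨ cong B (m+n∸n≡m 1 m) ⟩
      B 1                          ∎) (begin
      F m ⊓ B (suc m ∸ m)          ≤⟨ m⊓n≤n _ _ ⟩
      B (suc m ∸ m)                ≡⟨ cong B (m+n∸n≡m 1 m) ⟩
      B 1                          ≤⟨ ⟦forward⟧-mono k' k (s≤s z≤n) ⟩
      B (2 + m)                    ≡⟨ ⟦drop⟧ 2 (backward k k') m ⟨
      ⟦ drop 2 (backward k k') ⟧ m ∎)
    where open ≤-Reasoning
  δₒ-ahead (suc s) (s≤s s<m) = ≤-reflexive (cong (F s ⊓_) (begin
      B (suc m ∸ s)                          ≡⟨ cong B (∸-suc (m<n⇒m<1+n s<m)) ⟩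
      B (suc (m ∸ s))                        ≡⟨ cong (B ∘ suc) (∸-suc s<m) ⟩
      B (2 + (m ∸ suc s))                    ≡⟨ ⟦drop⟧ 2 (backward k k') (m ∸ suc s) ⟨
      ⟦ drop 2 (backward k k') ⟧ (m ∸ suc s) ∎))
    where open ≡-Reasoning

  δₒ-behind : ∀ r → r < suc m → δₒ m k k' r ≤ via m behind k k' (predMod m r)
  δₒ-behind zero _ = ⊓-glb (begin
      F 0 ⊓ B (suc m)              ≤⟨ m⊓n≤m _ _ ⟩
      F 0                          ≤⟨ ⟦forward⟧-mono k k' z≤n ⟩
      F (suc m)                    ≡⟨ ⟦tail⟧ (forward k k') m ⟨
      ⟦ tail (forward k k') ⟧ m    ∎) (begin
      F 0 ⊓ B (suc m)              ≤⟨ m⊓n≤m _ _ ⟩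
      B⁺ 0                         ≡⟨ cong B⁺ (n∸n≡0 m) ⟨
      B⁺ (m ∸ m)                   ∎)
    where open ≤-Reasoning
  δₒ-behind (suc s) (s≤s s<m) = ≤-reflexive (cong₂ _⊓_ (sym (⟦tail⟧ (forward k k') s)) (begin
      B (m ∸ s)                    ≡⟨ cong B (∸-suc s<m) ⟩
      B (suc (m ∸ suc s))          ≡⟨ ⟦tail⟧ (backward k k') (m ∸ suc s) ⟨
      B⁺ (suc (m ∸ suc s))         ≡⟨ cong B⁺ (∸-suc s<m) ⟨
      B⁺ (m ∸ s)                   ∎))
    where open ≡-Reasoning

δ≤via : ∀ s k k' {i i' : Fin (suc m)} (j : Fin (suc m)) → i ⟶[ s ] i' →
        δ (k , i') (k' , j) ≤ via m s k k' (offset i j)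
δ≤via stay k k' {i} j refl = ≤-reflexive (δₒ-stay k k' (offset<n i j))
δ≤via {m} ahead k k' {i} j refl =
  subst (λ r → δₒ m k k' r ≤ via m ahead k k' (offset i j)) (sym (offset-next i j))
        (δₒ-ahead k k' (offset i j) (offset<n i j))
δ≤via {m} behind k k' {i' = i'} j refl =
  subst (λ r → δₒ m k k' (offset i' j) ≤ via m behind k k' r) (sym (offset-next i' j))
        (δₒ-behind k k' (offset i' j) (offset<n i' j))

neighbours : Kind → Vec (Kind × Step) 3
neighbours a = (a , ahead) ∷ (a , behind) ∷ (b , stay) ∷ []
neighbours b = (a , stay) ∷ (c , stay) ∷ (c , behind) ∷ []
neighbours c = (b , stay) ∷ (b , ahead) ∷ (d , stay) ∷ []
neighbours d = (c , stay) ∷ (e , stay) ∷ (e , behind) ∷ []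
neighbours e = (d , stay) ∷ (d , ahead) ∷ (f , stay) ∷ []
neighbours f = (e , stay) ∷ (f , ahead) ∷ (f , behind) ∷ []

Adj⇒neighbour : ∀ {k k'} {i i' : Fin (suc m)} → Adj (k , i) (k' , i') →
                ∃[ s ] ((k' , s) ∈ᵥ neighbours k × i ⟶[ s ] i')
Adj⇒neighbour (inj₁ (aa i))  = ahead , here refl , refl
Adj⇒neighbour (inj₂ (aa i))  = behind , there (here refl) , refl
Adj⇒neighbour (inj₁ (ff i))  = ahead , there (here refl) , refl
Adj⇒neighbour (inj₂ (ff i))  = behind , there (there (here refl)) , refl
Adj⇒neighbour (inj₁ (ab i))  = stay , there (there (here refl)) , refl
Adj⇒neighbour (inj₂ (ab i))  = stay , here refl , refl
Adj⇒neighbour (inj₁ (cd i))  = stay , there (there (here refl)) , refl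
Adj⇒neighbour (inj₂ (cd i))  = stay , here refl , refl
Adj⇒neighbour (inj₁ (ef i))  = stay , there (there (here refl)) , refl
Adj⇒neighbour (inj₂ (ef i))  = stay , here refl , refl
Adj⇒neighbour (inj₁ (bc i))  = stay , there (here refl) , refl
Adj⇒neighbour (inj₂ (bc i))  = stay , here refl , refl
Adj⇒neighbour (inj₁ (b'c i)) = behind , there (there (here refl)) , refl
Adj⇒neighbour (inj₂ (b'c i)) = ahead , there (here refl) , refl
Adj⇒neighbour (inj₁ (de i))  = stay , there (here refl) , refl
Adj⇒neighbour (inj₂ (de i))  = stay , here refl , refl
Adj⇒neighbour (inj₁ (d'e i)) = behind , there (there (here refl)) , refl
Adj⇒neighbour (inj₂ (d'e i)) = ahead , there (here refl) , refl

neighbour⇒Adj : ∀ {k k' s} {i i' : Fin (suc m)} → (k' , s) ∈ᵥ neighbours k → i ⟶[ s ] i' → Adj (k , i) (k' , i')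
neighbour⇒Adj {k = a} {i = i} (here refl) refl = inj₁ (aa i)
neighbour⇒Adj {k = a} {i' = i'} (there (here refl)) refl = inj₂ (aa i')
neighbour⇒Adj {k = a} {i = i} (there (there (here refl))) refl = inj₁ (ab i)
neighbour⇒Adj {k = b} {i = i} (here refl) refl = inj₂ (ab i)
neighbour⇒Adj {k = b} {i = i} (there (here refl)) refl = inj₁ (bc i)
neighbour⇒Adj {k = b} {i' = i'} (there (there (here refl))) refl = inj₁ (b'c i')
neighbour⇒Adj {k = c} {i = i} (here refl) refl = inj₂ (bc i)
neighbour⇒Adj {k = c} {i = i} (there (here refl)) refl = inj₂ (b'c i)
neighbour⇒Adj {k = c} {i = i} (there (there (here refl))) refl = inj₁ (cd i)
neighbour⇒Adj {k = d} {i = i} (here refl) refl = inj₂ (cd i)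
neighbour⇒Adj {k = d} {i = i} (there (here refl)) refl = inj₁ (de i)
neighbour⇒Adj {k = d} {i' = i'} (there (there (here refl))) refl = inj₁ (d'e i')
neighbour⇒Adj {k = e} {i = i} (here refl) refl = inj₂ (de i)
neighbour⇒Adj {k = e} {i = i} (there (here refl)) refl = inj₂ (d'e i)
neighbour⇒Adj {k = e} {i = i} (there (there (here refl))) refl = inj₁ (ef i)
neighbour⇒Adj {k = f} {i = i} (here refl) refl = inj₂ (ef i)
neighbour⇒Adj {k = f} {i = i} (there (here refl)) refl = inj₁ (ff i)
neighbour⇒Adj {k = f} {i' = i'} (there (there (here refl))) refl = inj₂ (ff i')

StepCost : Kind → Kind × Step → Set
StepCost k (k₁ , s) = ∀ k' → forwardVia s k₁ k' ⊕ 0 ≤ₑ forward k k' ⊕ 1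
                           × backwardVia s k₁ k' ⊕ 0 ≤ₑ tail (backward k k') ⊕ 1

stepCost : ∀ k → All (StepCost k) (neighbours k)
stepCost = from-yes (∀-kind? λ k → All.all? (λ (k₁ , s) → ∀-kind? λ k' →
  ≤ₑ? (forwardVia s k₁ k') 0 (forward k k') 1 ×-dec ≤ₑ? (backwardVia s k₁ k') 0 (tail (backward k k')) 1) (neighbours k))

δ-lipschitz : {u w : V (suc m)} → Adj u w → ∀ x → δ w x ≤ suc (δ u x)
δ-lipschitz {m} {k , i} {k₁ , i'} adj (k' , j) with Adj⇒neighbour adj
... | s , nb , i⟶i' = begin
  δ (k₁ , i') (k' , j)            ≤⟨ δ≤via s k₁ k' j i⟶i' ⟩
  via m s k₁ k' r                 ≡⟨ +-identityʳ _ ⟨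
  via m s k₁ k' r + 0             ≤⟨ ⊓ₑ-mono F≤ B≤ r (m ∸ r) ⟩
  via m stay k k' r + 1           ≡⟨ cong (_+ 1) (δₒ-stay k k' (offset<n i j)) ⟨
  δ (k , i) (k' , j) + 1          ≡⟨ +-comm _ 1 ⟩
  suc (δ (k , i) (k' , j))        ∎
  where
  open ≤-Reasoning
  r = offset i j
  F≤ = proj₁ (All.lookup (stepCost k) nb k')
  B≤ = proj₂ (All.lookup (stepCost k) nb k')

Descent : (n : ℕ) → PointwiseProperty (suc n)
Descent n = record
  { Holds = Holds ; holds? = holds? ; HoldsUniformly = Uniformly ; holdsUniformly? = uniformly? ; uniformly = uniformly }
  where
  Holds : Vec ℕ (suc n) → Set
  Holds (v ∷ gs) = v ≡ 0 ⊎ Any (_< v) gs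
  holds? : ∀ xs → Dec (Holds xs)
  holds? (v ∷ gs) = (v ≟ 0) ⊎-dec any? (_<? v) gs
  Uniformly : Vec ℕ (suc n) → Set
  Uniformly (v ∷ gs) = Any (_< v) gs
  uniformly? : ∀ xs → Dec (Uniformly xs)
  uniformly? (v ∷ gs) = any? (_<? v) gs
  uniformly : ∀ t {xs} → Uniformly xs → Holds (map (t +_) xs)
  uniformly t {v ∷ gs} g<v = inj₂ (map⁺ (Any.map (+-monoʳ-< t) g<v))

-- Whenever δ is positive some neighbour of the source is strictly closer,
-- separately for the two ways around.
Descends : Kind → Kind → Set
Descends k k' =
  HoldsEverywhere (Descent 3) (forward k k' ∷ map (λ (k₁ , s) → forwardVia s k₁ k') (neighbours k)) ×
  HoldsEverywhere (Descent 3) (tail (backward k k') ∷ map (λ (k₁ , s) → backwardVia s k₁ k') (neighbours k))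

descends : ∀ k k' → Descends k k'
descends = from-yes (∀-kind? λ k → ∀-kind? λ k' →
  holdsEverywhere? (Descent 3) (forward k k' ∷ map (λ (k₁ , s) → forwardVia s k₁ k') (neighbours k)) ×-dec
  holdsEverywhere? (Descent 3) (tail (backward k k') ∷ map (λ (k₁ , s) → backwardVia s k₁ k') (neighbours k)))

closer-neighbour : ∀ {k k'} (i j : Fin (suc m)) {φ g z} → HoldsEverywhere (Descent 3) (φ ∷ map g (neighbours k)) →
                   ∀ t → ⟦ φ ⟧ t ≡ suc z → (∀ {k₁ s} → via m s k₁ k' (offset i j) ≤ ⟦ g (k₁ , s) ⟧ t) →
                   ∃[ w ] (Adj (k , i) w × δ w (k' , j) ≤ z)
closer-neighbour {m} {k} {k'} i j {φ} {g} {z} chk t φ≡ via≤g with holdsEverywhere (Descent 3) chk t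
... | inj₁ φ≡0 = contradiction (trans (sym φ≡) φ≡0) λ ()
... | inj₂ some with fromAny (map⁻ (map⁻ some))
... | (k₁ , s) , nb , g<φ with move s i
... | i' , i⟶i' = (k₁ , i') , neighbour⇒Adj nb i⟶i' , ≤-pred (begin-strict
  δ (k₁ , i') (k' , j)         ≤⟨ δ≤via s k₁ k' j i⟶i' ⟩
  via m s k₁ k' (offset i j)   ≤⟨ via≤g ⟩
  ⟦ g (k₁ , s) ⟧ t             <⟨ g<φ ⟩
  ⟦ φ ⟧ t                      ≡⟨ φ≡ ⟩
  suc z                        ∎)
  where open ≤-Reasoning

descent-step : (u x : V (suc m)) {z : ℕ} → δ u x ≡ suc z → ∃[ w ] (Adj u w × δ w x ≤ z)
descent-step {m} (k , i) (k' , j) {z} δ≡ with ⟦ forward k k' ⟧ (offset i j) ≤? ⟦ tail (backward k k') ⟧ (m ∸ offset i j)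
... | yes F≤B = closer-neighbour i j (proj₁ (descends k k')) (offset i j)
  (trans (sym (m≤n⇒m⊓n≡m F≤B)) δ≡via) λ {k₁} {s} → m⊓n≤m _ (⟦ backwardVia s k₁ k' ⟧ (m ∸ offset i j))
  where δ≡via = trans (sym (δₒ-stay k k' (offset<n i j))) δ≡
... | no F≰B = closer-neighbour i j (proj₂ (descends k k')) (m ∸ offset i j)
  (trans (sym (m≥n⇒m⊓n≡n (<⇒≤ (≰⇒> F≰B)))) δ≡via)
  λ {k₁} {s} → m⊓n≤n (⟦ forwardVia s k₁ k' ⟧ (offset i j)) _
  where δ≡via = trans (sym (δₒ-stay k k' (offset<n i j))) δ≡

forward-self : ∀ k → ⟦ forward k k ⟧ 0 ≡ 0
forward-self = from-yes (∀-kind? λ k → ⟦ forward k k ⟧ 0 ≟ 0)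

forward≡0⇒≡ : ∀ k k' → ⟦ forward k k' ⟧ 0 ≡ 0 → k ≡ k'
forward≡0⇒≡ = from-yes (∀-kind? λ k → ∀-kind? λ k' → (⟦ forward k k' ⟧ 0 ≟ 0) →-dec (k ≟ₖ k'))

-- Each edge changes the index by at most one.
forward-≥-index : ∀ k k' → ([] ▹ 0) ⊕ 0 ≤ₑ forward k k' ⊕ 0
forward-≥-index = from-yes (∀-kind? λ k → ∀-kind? λ k' → ≤ₑ? ([] ▹ 0) 0 (forward k k') 0)

index≤forward : ∀ k k' t → t ≤ ⟦ forward k k' ⟧ t
index≤forward k k' t = subst (_≤ ⟦ forward k k' ⟧ t) (+-identityʳ t) (≤ₑ-sound₀ (forward-≥-index k k') t)

δ-self : (u : V (suc m)) → δ u u ≡ 0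
δ-self (k , i) = n≤0⇒n≡0 (begin
  δ (k , i) (k , i)               ≤⟨ m⊓n≤m _ _ ⟩
  ⟦ forward k k ⟧ (offset i i)    ≡⟨ cong ⟦ forward k k ⟧ (offset-self i) ⟩
  ⟦ forward k k ⟧ 0               ≡⟨ forward-self k ⟩
  0                               ∎)
  where open ≤-Reasoning

δ≡0⇒≡ : (u x : V (suc m)) → δ u x ≡ 0 → u ≡ x
δ≡0⇒≡ {m} (k , i) (k' , j) δ≡0 with ⟦ forward k k' ⟧ (offset i j) ≤? ⟦ backward k k' ⟧ (suc m ∸ offset i j)
... | yes F≤B =
  cong₂ _,_ (forward≡0⇒≡ k k' (subst (λ r → ⟦ forward k k' ⟧ r ≡ 0) r≡0 F≡0)) (offset≡0⇒≡ r≡0)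
  where
  F≡0 = trans (sym (m≤n⇒m⊓n≡m F≤B)) δ≡0
  r≡0 = n≤0⇒n≡0 (subst (offset i j ≤_) F≡0 (index≤forward k k' (offset i j)))
... | no F≰B =
  contradiction (subst (suc m ∸ offset i j ≤_) B≡0 (index≤forward k' k _)) (<⇒≱ (m<n⇒0<n∸m (offset<n i j)))
  where B≡0 = trans (sym (m≥n⇒m⊓n≡n (<⇒≤ (≰⇒> F≰B)))) δ≡0

δ≤length : {u x : V (suc m)} {ℓ : ℕ} → Walk u x ℓ → δ u x ≤ ℓ
δ≤length {u = u} here = ≤-reflexive (δ-self u)
δ≤length {x = x} (step adj w) = ≤-trans (δ-lipschitz (swap adj) x) (s≤s (δ≤length w))

walk : ∀ ℓ (u x : V (suc m)) → δ u x ≡ ℓ → Walk u x ℓ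
walk zero u x δ≡0 = subst (λ v → Walk u v 0) (δ≡0⇒≡ u x δ≡0) here
walk (suc ℓ) u x δ≡ with descent-step u x δ≡
... | w , adj , δw≤ℓ = step adj (walk ℓ w x (≤-antisym δw≤ℓ ℓ≤δw))
  where
  ℓ≤δw : ℓ ≤ δ w x
  ℓ≤δw = ≤-pred (subst (_≤ suc (δ w x)) δ≡ (δ-lipschitz (swap adj) x))

δ-isDist : (u x : V (suc m)) → Dist u x (δ u x)
δ-isDist u x = walk (δ u x) u x refl , λ ℓ ℓ<δ w → <⇒≱ ℓ<δ (δ≤length w)

Dist⇒≡δ : {u x : V (suc m)} {ℓ : ℕ} → Dist u x ℓ → ℓ ≡ δ u x
Dist⇒≡δ {u = u} {x} (w , minimal) =
  ≤-antisym (≮⇒≥ λ δ<ℓ → minimal (δ u x) δ<ℓ (proj₁ (δ-isDist u x))) (δ≤length w)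

-- The lower bound

inverse : Step → Step
inverse stay = stay
inverse ahead = behind
inverse behind = ahead

⟶-inverse : ∀ s {i i' : Fin (suc m)} → i ⟶[ s ] i' → i' ⟶[ inverse s ] i
⟶-inverse stay refl = refl
⟶-inverse ahead refl = refl
⟶-inverse behind refl = refl

Closer : Step → Kind → Kind → Kind → Set
Closer s k₁ k₂ k' = forwardVia s k₁ k' ⊕ 1 ≤ₑ forward k₂ k' ⊕ 0
                   × backwardVia s k₁ k' ⊕ 1 ≤ₑ tail (backward k₂ k') ⊕ 0

closer? : ∀ s k₁ k₂ k' → Dec (Closer s k₁ k₂ k')
closer? s k₁ k₂ k' = ≤ₑ? (forwardVia s k₁ k') 1 (forward k₂ k') 0
               ×-dec ≤ₑ? (backwardVia s k₁ k') 1 (tail (backward k₂ k')) 0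

closer⇒< : ∀ {s k₁ k₂ k'} {i i' : Fin (suc m)} j → i ⟶[ s ] i' → Closer s k₁ k₂ k' →
           δ (k₁ , i') (k' , j) < δ (k₂ , i) (k' , j)
closer⇒< {m} {s} {k₁} {k₂} {k'} {i} {i'} j i⟶i' (F< , B<) = begin-strict
  δ (k₁ , i') (k' , j)     ≤⟨ δ≤via s k₁ k' j i⟶i' ⟩
  via m s k₁ k' r          <⟨ subst₂ _≤_ (+-comm _ 1) (+-identityʳ _) (⊓ₑ-mono F< B< r (m ∸ r)) ⟩
  via m stay k₂ k' r       ≡⟨ δₒ-stay k₂ k' (offset<n i j) ⟨
  δ (k₂ , i) (k' , j)      ∎
  where
  open ≤-Reasoning
  r = offset i j

Separated : Kind → Step → Kind → Set
Separated k₁ s k₂ = ∀ k' → Closer s k₁ k₂ k' ⊎ Closer (inverse s) k₂ k₁ k'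

separated⇒≢ : ∀ {k₁ s k₂} {i i' : Fin (suc m)} → Separated k₁ s k₂ → i ⟶[ s ] i' →
              ∀ x → δ (k₁ , i') x ≢ δ (k₂ , i) x
separated⇒≢ {s = s} sep i⟶i' (k' , j) δ≡ with sep k'
... | inj₁ k₁-closer = <⇒≢ (closer⇒< j i⟶i' k₁-closer) δ≡
... | inj₂ k₂-closer = <⇒≢ (closer⇒< j (⟶-inverse s i⟶i') k₂-closer) (sym δ≡)

-- (k₁ , s , k₂) stands for the pairs of k₁ moved by s from i and k₂ at i:
-- {aᵢ₊₁, fᵢ}, {bᵢ₊₁, eᵢ}, {cᵢ, dᵢ}.
twin : Fin 3 → Kind × Step × Kind
twin zero = a , ahead , f
twin (suc zero) = b , ahead , e
twin (suc (suc zero)) = c , stay , d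

TwinsSeparated : Kind × Step × Kind → Set
TwinsSeparated (k₁ , s , k₂) = k₁ ≢ k₂ × Separated k₁ s k₂

twinsSeparated : ∀ p → TwinsSeparated (twin p)
twinsSeparated = from-yes (all? λ p → let (k₁ , s , k₂) = twin p in
  ¬? (k₁ ≟ₖ k₂) ×-dec ∀-kind? λ k' → closer? s k₁ k₂ k' ⊎-dec closer? (inverse s) k₂ k₁ k')

twinMembers : Fin 3 → Fin (suc m) → V (suc m) × V (suc m)
twinMembers p w = let (k₁ , s , k₂) = twin p in (k₁ , proj₁ (move s w)) , (k₂ , w)

twinIndex : V (suc m) → Fin 3 × Fin (suc m)
twinIndex (a , i) = zero , prev i
twinIndex (b , i) = suc zero , prev i
twinIndex (c , i) = suc (suc zero) , i
twinIndex (d , i) = suc (suc zero) , i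
twinIndex (e , i) = suc zero , i
twinIndex (f , i) = zero , i

prev-next : (i : Fin (suc m)) → prev (next i) ≡ i
prev-next i = next-injective (next-prev (next i))

twinIndex-twinMembers : ∀ p (w : Fin (suc m)) →
  twinIndex (proj₁ (twinMembers p w)) ≡ (p , w) × twinIndex (proj₂ (twinMembers p w)) ≡ (p , w)
twinIndex-twinMembers zero w = cong (zero ,_) (prev-next w) , refl
twinIndex-twinMembers (suc zero) w = cong (suc zero ,_) (prev-next w) , refl
twinIndex-twinMembers (suc (suc zero)) w = refl , refl

_≟ᵥ_ : (u v : V (suc m)) → Dec (u ≡ v)
_≟ᵥ_ = ≡-dec _≟ₖ_ Fin._≟_

equalizer-meets : (S : List (V (suc m))) → DistanceEqualizer S →
                  ∀ {u v} → u ≢ v → (∀ x → δ u x ≢ δ v x) → u ∈ S ⊎ v ∈ S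
equalizer-meets S equalizer {u} {v} u≢v unequal with _∈?_ _≟ᵥ_ u S | _∈?_ _≟ᵥ_ v S
... | yes u∈S | _ = inj₁ u∈S
... | no _ | yes v∈S = inj₂ v∈S
... | no u∉S | no v∉S with equalizer u v u≢v u∉S v∉S
... | x , _ , _ , Du , Dv = contradiction (trans (sym (Dist⇒≡δ Du)) (Dist⇒≡δ Dv)) (unequal x)

twins-unequal : ∀ p (w : Fin (suc m)) x → δ (proj₁ (twinMembers p w)) x ≢ δ (proj₂ (twinMembers p w)) x
twins-unequal p w = separated⇒≢ {k₁ = k₁} {s} {k₂} (proj₂ (twinsSeparated p)) (proj₂ (move s w))
  where
  k₁ = proj₁ (twin p)
  s = proj₁ (proj₂ (twin p))
  k₂ = proj₂ (proj₂ (twin p))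

twins-distinct : ∀ p (w : Fin (suc m)) → proj₁ (twinMembers p w) ≢ proj₂ (twinMembers p w)
twins-distinct p w = proj₁ (twinsSeparated p) ∘ cong proj₁

twinInEqualizer : (S : List (V (suc m))) → DistanceEqualizer S → ∀ pw → ∃[ v ] (v ∈ S × twinIndex v ≡ pw)
twinInEqualizer S equalizer (p , w) with equalizer-meets S equalizer (twins-distinct p w) (twins-unequal p w)
... | inj₁ u∈S = _ , u∈S , proj₁ (twinIndex-twinMembers p w)
... | inj₂ v∈S = _ , v∈S , proj₂ (twinIndex-twinMembers p w)

injection⇒≤length : ∀ {A : Set} {k} (S : List A) (g : Fin k → A) →
                    (∀ x → g x ∈ S) → (∀ {x y} → g x ≡ g y → x ≡ y) → k ≤ length S
injection⇒≤length S g g∈S g-injective = injective⇒≤ λ {x} {y} eq →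
  g-injective (trans (lookup-index (g∈S x)) (trans (cong (List.lookup S) eq) (sym (lookup-index (g∈S y)))))

remQuot-injective : ∀ {k} n {x y : Fin (k * n)} → remQuot {k} n x ≡ remQuot n y → x ≡ y
remQuot-injective {k} n {x} {y} eq =
  trans (sym (combine-remQuot {k} n x)) (trans (cong (uncurry (combine {k} {n})) eq) (combine-remQuot {k} n y))

DistanceEqualizer⇒3n≤length : (S : List (V (suc m))) → DistanceEqualizer S → 3 * suc m ≤ length S
DistanceEqualizer⇒3n≤length {m} S equalizer =
  injection⇒≤length S (proj₁ ∘ chosen) (proj₁ ∘ proj₂ ∘ chosen) λ {x} {y} eq →
  remQuot-injective {3} (suc m) (trans (sym (proj₂ (proj₂ (chosen x)))) (trans (cong twinIndex eq) (proj₂ (proj₂ (chosen y)))))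
  where
  chosen : ∀ x → ∃[ v ] (v ∈ S × twinIndex v ≡ remQuot {3} (suc m) x)
  chosen x = twinInEqualizer S equalizer (remQuot (suc m) x)

-- The upper bound

level : Kind → ℕ
level a = 0
level b = 0
level c = 1
level d = 1
level e = 2
level f = 2

-- The forward way to an offset is never longer than the backward way to the
-- same offset plus this slack.
slack : Kind → Kind → ℕ
slack k k' = level k' ∸ level k

forward≤backward : ∀ k k' → forward k k' ⊕ 0 ≤ₑ drop (slack k k') (backward k k') ⊕ 0
forward≤backward = from-yes (∀-kind? λ k → ∀-kind? λ k' → ≤ₑ? (forward k k') 0 (drop (slack k k') (backward k k')) 0)

⟦forward⟧≤⟦backward⟧ : ∀ k k' t → ⟦ forward k k' ⟧ t ≤ ⟦ backward k k' ⟧ (slack k k' + t)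
⟦forward⟧≤⟦backward⟧ k k' t = begin
  ⟦ forward k k' ⟧ t                              ≤⟨ ≤ₑ-sound₀ (forward≤backward k k') t ⟩
  ⟦ drop (slack k k') (backward k k') ⟧ t         ≡⟨ ⟦drop⟧ (slack k k') (backward k k') t ⟩
  ⟦ backward k k' ⟧ (slack k k' + t)              ∎
  where open ≤-Reasoning

δ-forward : ∀ k k' {i l : Fin (suc m)} {p} → offset i l ≡ p → slack k k' + p + p ≤ suc m →
            δ (k , i) (k' , l) ≡ ⟦ forward k k' ⟧ p
δ-forward {m} k k' {p = p} refl short = m≤n⇒m⊓n≡m (begin
  ⟦ forward k k' ⟧ p                   ≤⟨ ⟦forward⟧≤⟦backward⟧ k k' p ⟩
  ⟦ backward k k' ⟧ (slack k k' + p)   ≤⟨ ⟦forward⟧-mono k' k (m+n≤o⇒m≤o∸n (slack k k' + p) short) ⟩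
  ⟦ backward k k' ⟧ (suc m ∸ p)        ∎)
  where open ≤-Reasoning

δ-backward : ∀ k k' {i l : Fin (suc m)} {q} → offset i l + q ≡ suc m → slack k' k + q + q ≤ suc m →
             δ (k , i) (k' , l) ≡ ⟦ backward k k' ⟧ q
δ-backward {m} k k' {i} {l} {q} o+q≡n short =
  trans (cong (λ z → ⟦ forward k k' ⟧ o ⊓ ⟦ backward k k' ⟧ z) n∸o≡q) (m≥n⇒m⊓n≡n B≤F)
  where
  o = offset i l
  n∸o≡q : suc m ∸ o ≡ q
  n∸o≡q = trans (cong (_∸ o) (sym o+q≡n)) (m+n∸m≡n o q)
  n∸q≡o : suc m ∸ q ≡ o
  n∸q≡o = trans (cong (_∸ q) (sym o+q≡n)) (m+n∸n≡m o q)
  B≤F : ⟦ backward k k' ⟧ q ≤ ⟦ forward k k' ⟧ o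
  B≤F = begin
    ⟦ backward k k' ⟧ q                  ≤⟨ ⟦forward⟧≤⟦backward⟧ k' k q ⟩
    ⟦ forward k k' ⟧ (slack k' k + q)    ≤⟨ ⟦forward⟧-mono k k' (subst (slack k' k + q ≤_) n∸q≡o
                                              (m+n≤o⇒m≤o∸n (slack k' k + q) short)) ⟩
    ⟦ forward k k' ⟧ o                   ∎
    where open ≤-Reasoning

record EqualizedIn (k' : Kind) (u v : V (suc m)) : Set where
  constructor _,_
  field
    position   : Fin (suc m)
    equidistant : δ u (k' , position) ≡ δ v (k' , position)

double≤⇒< : ∀ s n → s + n + n ≤ suc m → n < suc m
double≤⇒< s zero _ = z<s
double≤⇒< {m} s (suc n) short = s≤s (begin
  suc n              ≤⟨ m≤n+m (suc n) n ⟩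
  n + suc n          ≤⟨ ≤-pred (m+n≤o⇒n≤o s (subst (_≤ suc m) (+-assoc s (suc n) (suc n)) short)) ⟩
  m                  ∎)
  where open ≤-Reasoning

-- The vertex equidistant from u = k₁ᵢ and v = k₂ⱼ is placed between them
-- (near), past v and reached from u backwards around the cycle (far), ahead
-- of both, or behind both.
near-placement : ∀ {k₁ k₂ k'} {i j : Fin (suc m)} p q → offset i j ≡ p + q → 1 ≤ q →
                 slack k₁ k' + p + p ≤ suc m → slack k' k₂ + q + q ≤ suc m →
                 ⟦ forward k₁ k' ⟧ p ≡ ⟦ backward k₂ k' ⟧ q → EqualizedIn k' (k₁ , i) (k₂ , j)
near-placement {m} {k₁} {k₂} {k'} {i} {j} p q t≡ 1≤q u-short v-short F≡B = l , (begin
  δ (k₁ , i) (k' , l)      ≡⟨ δ-forward k₁ k' il≡p u-short ⟩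
  ⟦ forward k₁ k' ⟧ p      ≡⟨ F≡B ⟩
  ⟦ backward k₂ k' ⟧ q     ≡⟨ δ-backward k₂ k' jl+q≡n v-short ⟨
  δ (k₂ , j) (k' , l)      ∎)
  where
  open ≡-Reasoning
  N = suc m
  q≤N = <⇒≤ (double≤⇒< (slack k' k₂) q v-short)
  l = proj₁ (∃-offset i (double≤⇒< (slack k₁ k') p u-short))
  il≡p = proj₂ (∃-offset i (double≤⇒< (slack k₁ k') p u-short))
  around : (p + q + (N ∸ q)) % N ≡ p % N
  around = trans (cong (_% N) (trans (+-assoc p q (N ∸ q)) (cong (p +_) (m+[n∸m]≡n q≤N)))) ([m+n]%n≡m%n p N)
  jl+q≡n : offset j l + q ≡ N
  jl+q≡n = trans (cong (_+ q) (offset-compose t≡ il≡p (∸-monoʳ-< 1≤q q≤N) around)) (m∸n+n≡m q≤N)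

far-placement : ∀ {k₁ k₂ k'} {i j : Fin (suc m)} {t} p q → offset i j ≡ t → t + q + p ≡ suc m → 1 ≤ p →
                slack k' k₁ + p + p ≤ suc m → slack k₂ k' + q + q ≤ suc m →
                ⟦ backward k₁ k' ⟧ p ≡ ⟦ forward k₂ k' ⟧ q → EqualizedIn k' (k₁ , i) (k₂ , j)
far-placement {m} {k₁} {k₂} {k'} {i} {j} {t} p q t≡ around 1≤p u-short v-short B≡F = l , (begin
  δ (k₁ , i) (k' , l)      ≡⟨ δ-backward k₁ k' (trans (cong (_+ p) il≡t+q) around) u-short ⟩
  ⟦ backward k₁ k' ⟧ p     ≡⟨ B≡F ⟩
  ⟦ forward k₂ k' ⟧ q      ≡⟨ δ-forward k₂ k' jl≡q v-short ⟨
  δ (k₂ , j) (k' , l)      ∎)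
  where
  open ≡-Reasoning
  t+q<N : t + q < suc m
  t+q<N = subst (t + q <_) around (subst (_≤ t + q + p) (+-comm (t + q) 1) (+-monoʳ-≤ (t + q) 1≤p))
  l = proj₁ (∃-offset i t+q<N)
  il≡t+q = proj₂ (∃-offset i t+q<N)
  jl≡q = offset-compose t≡ il≡t+q (double≤⇒< (slack k₂ k') q v-short) refl

ahead-placement : ∀ {k₁ k₂ k'} {i j : Fin (suc m)} {t} q → offset i j ≡ t →
                  slack k₁ k' + (t + q) + (t + q) ≤ suc m → slack k₂ k' + q + q ≤ suc m →
                  ⟦ forward k₁ k' ⟧ (t + q) ≡ ⟦ forward k₂ k' ⟧ q → EqualizedIn k' (k₁ , i) (k₂ , j)
ahead-placement {m} {k₁} {k₂} {k'} {i} {j} {t} q t≡ u-short v-short F≡F = l , (begin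
  δ (k₁ , i) (k' , l)        ≡⟨ δ-forward k₁ k' il≡t+q u-short ⟩
  ⟦ forward k₁ k' ⟧ (t + q)  ≡⟨ F≡F ⟩
  ⟦ forward k₂ k' ⟧ q        ≡⟨ δ-forward k₂ k' jl≡q v-short ⟨
  δ (k₂ , j) (k' , l)        ∎)
  where
  open ≡-Reasoning
  l = proj₁ (∃-offset i (double≤⇒< (slack k₁ k') (t + q) u-short))
  il≡t+q = proj₂ (∃-offset i (double≤⇒< (slack k₁ k') (t + q) u-short))
  jl≡q = offset-compose t≡ il≡t+q (double≤⇒< (slack k₂ k') q v-short) refl

behind-placement : ∀ {k₁ k₂ k'} {i j : Fin (suc m)} {t} p → offset i j ≡ t → 1 ≤ p →
                   slack k' k₁ + p + p ≤ suc m → slack k' k₂ + (p + t) + (p + t) ≤ suc m →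
                   ⟦ backward k₁ k' ⟧ p ≡ ⟦ backward k₂ k' ⟧ (p + t) → EqualizedIn k' (k₁ , i) (k₂ , j)
behind-placement {m} {k₁} {k₂} {k'} {i} {j} {t} p t≡ 1≤p u-short v-short B≡B = l , (begin
  δ (k₁ , i) (k' , l)          ≡⟨ δ-backward k₁ k' (trans (cong (_+ p) il≡N∸p) (m∸n+n≡m p≤N)) u-short ⟩
  ⟦ backward k₁ k' ⟧ p         ≡⟨ B≡B ⟩
  ⟦ backward k₂ k' ⟧ (p + t)   ≡⟨ δ-backward k₂ k' (trans (cong (_+ (p + t)) jl≡) (m∸n+n≡m p+t≤N)) v-short ⟨
  δ (k₂ , j) (k' , l)          ∎)
  where
  open ≡-Reasoning
  N = suc m
  p+t≤N = <⇒≤ (double≤⇒< (slack k' k₂) (p + t) v-short)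
  p≤N = ≤-trans (m≤m+n p t) p+t≤N
  l = proj₁ (∃-offset i (∸-monoʳ-< 1≤p p≤N))
  il≡N∸p = proj₂ (∃-offset i (∸-monoʳ-< 1≤p p≤N))
  t+[N∸[p+t]]≡N∸p : t + (N ∸ (p + t)) ≡ N ∸ p
  t+[N∸[p+t]]≡N∸p = trans (cong (t +_) (sym (∸-+-assoc N p t)))
    (m+[n∸m]≡n (m+n≤o⇒m≤o∸n t (subst (_≤ N) (+-comm p t) p+t≤N)))
  jl≡ : offset j l ≡ N ∸ (p + t)
  jl≡ = offset-compose t≡ il≡N∸p (∸-monoʳ-< (≤-trans 1≤p (m≤m+n p t)) p+t≤N) (cong (_% N) t+[N∸[p+t]]≡N∸p)

gap≥ : ∀ {w y₀ H} ν g → y₀ ≤ 1 → y₀ + w ≤ 3 → 3 ≤ H → w + (ν + ν) + g ≡ H → y₀ ≤ ν + g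
gap≥ (suc ν) g y₀≤1 _ _ _ = ≤-trans y₀≤1 (s≤s z≤n)
gap≥ {w} {y₀} {H} zero g _ y₀+w≤3 H≥3 H≡ = +-cancelˡ-≤ w y₀ g (begin
  w + y₀      ≡⟨ +-comm w y₀ ⟩
  y₀ + w      ≤⟨ y₀+w≤3 ⟩
  3           ≤⟨ H≥3 ⟩
  H           ≡⟨ H≡ ⟨
  w + 0 + g   ≡⟨ cong (_+ g) (+-identityʳ w) ⟩
  w + g       ∎)
  where open ≤-Reasoning

record WithinHalf (H : ℕ) (i j : Fin (suc m)) : Set where
  field
    size     : suc m ≡ H + H
    H≥3      : 3 ≤ H
    offset≤H : offset i j ≤ H

module _ {H} {i j : Fin (suc m)} (within : WithinHalf H i j) where
  open WithinHalf within

  twice-offset≤ : offset i j + offset i j ≤ suc m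
  twice-offset≤ = subst (offset i j + offset i j ≤_) (sym size) (+-mono-≤ offset≤H offset≤H)

  six≤ : 6 ≤ suc m
  six≤ = subst (6 ≤_) (sym size) (+-mono-≤ H≥3 H≥3)

  size-via-gap : suc m ≡ (offset i j + (H ∸ offset i j)) + (offset i j + (H ∸ offset i j))
  size-via-gap = trans size (cong (λ h → h + h) (sym (m+[n∸m]≡n offset≤H)))

near-between : ∀ {k₁ k₂} k' p q {i j : Fin (suc m)} → offset i j ≡ p + q → (p + q) + (p + q) ≤ suc m → 1 ≤ q →
               slack k₁ k' ≤ q + q → slack k' k₂ ≤ p + p → ⟦ forward k₁ k' ⟧ p ≡ ⟦ backward k₂ k' ⟧ q →
               EqualizedIn k' (k₁ , i) (k₂ , j)
near-between {m} {k₁} {k₂} k' p q t≡ 2t≤N 1≤q slack₁≤ slack₂≤ F≡B =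
  near-placement p q t≡ 1≤q (short q p slack₁≤ (solve 2 (λ p q → (p :+ q) :+ (p :+ q) := q :+ q :+ p :+ p) refl p q))
                            (short p q slack₂≤ (solve 2 (λ p q → (p :+ q) :+ (p :+ q) := p :+ p :+ q :+ q) refl p q)) F≡B
  where
  short : ∀ {s} x y → s ≤ x + x → (p + q) + (p + q) ≡ x + x + y + y → s + y + y ≤ suc m
  short x y s≤ shuffle = ≤-trans (+-monoˡ-≤ y (+-monoˡ-≤ y s≤)) (subst (_≤ suc m) shuffle 2t≤N)

module _ {H} {k₁ k₂ : Kind} {i j : Fin (suc m)} (within : WithinHalf H i j) (k' : Kind) where
  open WithinHalf within

  near-point : ∀ p q → offset i j ≡ p + q →
               {_ : True (1 ≤? q)} {_ : True (slack k₁ k' ≤? q + q)} {_ : True (slack k' k₂ ≤? p + p)}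
               {_ : True (⟦ forward k₁ k' ⟧ p ≟ ⟦ backward k₂ k' ⟧ q)} → EqualizedIn k' (k₁ , i) (k₂ , j)
  near-point p q t≡ {1≤q} {slack₁≤} {slack₂≤} {F≡B} =
    near-between k' p q t≡ (subst (λ t → t + t ≤ suc m) t≡ (twice-offset≤ within))
                 (toWitness 1≤q) (toWitness slack₁≤) (toWitness slack₂≤) (toWitness F≡B)

  near-family : ∀ cp cq ν → offset i j ≡ (cp + cq) + (ν + ν) →
                {_ : True (1 ≤? cq)} {_ : True (slack k₁ k' ≤? cq + cq)} {_ : True (slack k' k₂ ≤? cp + cp)}
                {_ : drop cp (forward k₁ k') ≡ₑ drop cq (backward k₂ k')} → EqualizedIn k' (k₁ , i) (k₂ , j)
  near-family cp cq ν t≡ {1≤cq} {slack₁≤} {slack₂≤} {F≡B} =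
    near-between k' (cp + ν) (cq + ν) t≡′ (subst (λ t → t + t ≤ suc m) t≡′ (twice-offset≤ within))
                 (≤-trans (toWitness 1≤cq) (m≤m+n cq ν))
                 (≤-trans (toWitness slack₁≤) (+-mono-≤ (m≤m+n cq ν) (m≤m+n cq ν)))
                 (≤-trans (toWitness slack₂≤) (+-mono-≤ (m≤m+n cp ν) (m≤m+n cp ν)))
                 (drop-≡ₑ⇒≡ cp cq 0 F≡B ν z≤n)
    where
    t≡′ : offset i j ≡ (cp + ν) + (cq + ν)
    t≡′ = trans t≡ (solve 3 (λ cp cq ν → (cp :+ cq) :+ (ν :+ ν) := (cp :+ ν) :+ (cq :+ ν)) refl cp cq ν)

  ahead-point : ∀ t q → offset i j ≡ t →
                {_ : True (slack k₁ k' + (t + q) + (t + q) ≤? 6)} {_ : True (slack k₂ k' + q + q ≤? 6)}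
                {_ : True (⟦ forward k₁ k' ⟧ (t + q) ≟ ⟦ forward k₂ k' ⟧ q)} → EqualizedIn k' (k₁ , i) (k₂ , j)
  ahead-point t q t≡ {u-short} {v-short} {F≡F} =
    ahead-placement q t≡ (≤-trans (toWitness u-short) (six≤ within))
                    (≤-trans (toWitness v-short) (six≤ within)) (toWitness F≡F)

  behind-point : ∀ t p → offset i j ≡ t →
                 {_ : True (1 ≤? p)} {_ : True (slack k' k₁ + p + p ≤? 6)} {_ : True (slack k' k₂ + (p + t) + (p + t) ≤? 6)}
                 {_ : True (⟦ backward k₁ k' ⟧ p ≟ ⟦ backward k₂ k' ⟧ (p + t))} → EqualizedIn k' (k₁ , i) (k₂ , j)
  behind-point t p t≡ {1≤p} {u-short} {v-short} {B≡B} =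
    behind-placement p t≡ (toWitness 1≤p) (≤-trans (toWitness u-short) (six≤ within))
                     (≤-trans (toWitness v-short) (six≤ within)) (toWitness B≡B)

  -- The two tables may agree only from y₀ on; the shift ν + (H ∸ t) reaches
  -- y₀ because H ≥ 3.
  far-family : ∀ cp cq y₀ ν → offset i j ≡ (cp + cq) + (ν + ν) →
               {_ : True (1 ≤? cp)} {_ : True (slack k' k₁ ≤? cq + cq)} {_ : True (slack k₂ k' ≤? cp + cp)}
               {_ : True (y₀ ≤? 1)} {_ : True (y₀ + (cp + cq) ≤? 3)}
               {_ : drop (y₀ + cp) (backward k₁ k') ≡ₑ drop (y₀ + cq) (forward k₂ k')} →
               EqualizedIn k' (k₁ , i) (k₂ , j)
  far-family cp cq y₀ ν t≡ {1≤cp} {slack₁≤} {slack₂≤} {y₀≤1} {y₀+c≤3} {B≡F} =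
    far-placement (cp + s) (cq + s) t≡ around (≤-trans (toWitness 1≤cp) (m≤m+n cp s))
      (short cq (cp + s) (toWitness slack₁≤) (solve 4 (λ cp cq ν g →
        let half = (cp :+ cq) :+ (ν :+ ν) :+ g in
        half :+ half := cq :+ cq :+ (cp :+ (ν :+ g)) :+ (cp :+ (ν :+ g)) :+ (ν :+ ν)) refl cp cq ν g))
      (short cp (cq + s) (toWitness slack₂≤) (solve 4 (λ cp cq ν g →
        let half = (cp :+ cq) :+ (ν :+ ν) :+ g in
        half :+ half := cp :+ cp :+ (cq :+ (ν :+ g)) :+ (cq :+ (ν :+ g)) :+ (ν :+ ν)) refl cp cq ν g))
      B≡F′
    where
    g = H ∸ offset i j
    s = ν + g
    half = (cp + cq) + (ν + ν) + g
    N≡ : suc m ≡ half + half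
    N≡ = trans (size-via-gap within) (cong (λ t → (t + g) + (t + g)) t≡)
    around : (cp + cq) + (ν + ν) + (cq + s) + (cp + s) ≡ suc m
    around = trans (solve 4 (λ cp cq ν g → let half = (cp :+ cq) :+ (ν :+ ν) :+ g in
      (cp :+ cq) :+ (ν :+ ν) :+ (cq :+ (ν :+ g)) :+ (cp :+ (ν :+ g)) := half :+ half) refl cp cq ν g) (sym N≡)
    short : ∀ {σ} x y → σ ≤ x + x → half + half ≡ x + x + y + y + (ν + ν) → σ + y + y ≤ suc m
    short x y σ≤ shuffle = ≤-trans (+-monoˡ-≤ y (+-monoˡ-≤ y σ≤))
      (≤-trans (m≤m+n (x + x + y + y) (ν + ν)) (≤-reflexive (sym (trans N≡ shuffle))))
    B≡F′ : ⟦ backward k₁ k' ⟧ (cp + s) ≡ ⟦ forward k₂ k' ⟧ (cq + s)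
    B≡F′ = drop-≡ₑ⇒≡ cp cq y₀ B≡F s (gap≥ ν g (toWitness y₀≤1) (toWitness y₀+c≤3) H≥3
      (trans (cong (_+ g) (sym t≡)) (m+[n∸m]≡n offset≤H)))

data Halving : ℕ → Set where
  even : ∀ μ → Halving (μ + μ)
  odd  : ∀ μ → Halving (suc (μ + μ))

halve : ∀ n → Halving n
halve zero = even 0
halve (suc n) with halve n
... | even μ = odd μ
... | odd μ = subst Halving (cong suc (+-suc μ μ)) (even (suc μ))

double-+ : ∀ x ν → (x + ν) + (x + ν) ≡ (x + x) + (ν + ν)
double-+ x ν = solve 2 (λ x ν → (x :+ ν) :+ (x :+ ν) := (x :+ x) :+ (ν :+ ν)) refl x ν

data Outside : Kind → Set where
  a∉ : Outside a
  b∉ : Outside b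
  c∉ : Outside c

equalizerRows : List Kind
equalizerRows = d ∷ e ∷ f ∷ []

Equalized : V (suc m) → V (suc m) → Set
Equalized u v = ∃[ k' ] (k' ∈ equalizerRows × EqualizedIn k' u v)

pattern d∈ = here refl
pattern e∈ = there (here refl)
pattern f∈ = there (there (here refl))

equalized-≤H : ∀ {k₁ k₂} → Outside k₁ → Outside k₂ → ∀ {H} {i j : Fin (suc m)} →
               WithinHalf H i j → (k₁ , i) ≢ (k₂ , j) →
               ∀ {t} → offset i j ≡ t → Halving t → Equalized (k₁ , i) (k₂ , j)
equalized-≤H a∉ a∉ σ u≢v t≡ (even zero)              = ⊥-elim (u≢v (cong (a ,_) (offset≡0⇒≡ t≡)))
equalized-≤H a∉ a∉ σ _ t≡ (even (suc ν))             = e , e∈ , near-family σ e 0 2 ν (trans t≡ (double-+ 1 ν))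
equalized-≤H a∉ a∉ σ _ t≡ (odd ν)                    = d , d∈ , near-family σ d 0 1 ν t≡
equalized-≤H a∉ b∉ σ _ t≡ (even 0)                   = d , d∈ , ahead-point σ d 0 1 t≡
equalized-≤H a∉ b∉ σ _ t≡ (even 1)                   = f , f∈ , behind-point σ f 2 1 t≡
equalized-≤H a∉ b∉ σ _ t≡ (even 2)                   = e , e∈ , near-point σ e 1 3 t≡
equalized-≤H a∉ b∉ σ _ t≡ (even (suc (suc (suc ν)))) = d , d∈ , near-family σ d 3 3 ν (trans t≡ (double-+ 3 ν))
equalized-≤H a∉ b∉ σ _ t≡ (odd ν)                    = f , f∈ , far-family σ f 1 0 1 ν t≡
equalized-≤H a∉ c∉ σ _ t≡ (even 0)                   = d , d∈ , ahead-point σ d 0 2 t≡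
equalized-≤H a∉ c∉ σ _ t≡ (even (suc ν))             = f , f∈ , far-family σ f 1 1 1 ν (trans t≡ (double-+ 1 ν))
equalized-≤H a∉ c∉ σ _ t≡ (odd 0)                    = d , d∈ , near-point σ d 0 1 t≡
equalized-≤H a∉ c∉ σ _ t≡ (odd (suc ν))              = f , f∈ , near-family σ f 0 3 ν (trans t≡ (cong suc (double-+ 1 ν)))
equalized-≤H b∉ a∉ σ _ t≡ (even 0)                   = d , d∈ , ahead-point σ d 0 1 t≡
equalized-≤H b∉ a∉ σ _ t≡ (even 1)                   = f , f∈ , near-point σ f 1 1 t≡
equalized-≤H b∉ a∉ σ _ t≡ (even 2)                   = e , e∈ , near-point σ e 1 3 t≡
equalized-≤H b∉ a∉ σ _ t≡ (even (suc (suc (suc ν)))) = d , d∈ , near-family σ d 2 4 ν (trans t≡ (double-+ 3 ν))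
equalized-≤H b∉ a∉ σ _ t≡ (odd 0)                    = f , f∈ , ahead-point σ f 1 0 t≡
equalized-≤H b∉ a∉ σ _ t≡ (odd (suc ν))              = f , f∈ , near-family σ f 1 2 ν (trans t≡ (cong suc (double-+ 1 ν)))
equalized-≤H b∉ b∉ σ u≢v t≡ (even zero)              = ⊥-elim (u≢v (cong (b ,_) (offset≡0⇒≡ t≡)))
equalized-≤H b∉ b∉ σ _ t≡ (even (suc ν))             = e , e∈ , near-family σ e 0 2 ν (trans t≡ (double-+ 1 ν))
equalized-≤H b∉ b∉ σ _ t≡ (odd ν)                    = d , d∈ , near-family σ d 0 1 ν t≡
equalized-≤H b∉ c∉ σ _ t≡ (even 0)                   = f , f∈ , behind-point σ f 0 2 t≡
equalized-≤H b∉ c∉ σ _ t≡ (even (suc ν))             = f , f∈ , near-family σ f 0 2 ν (trans t≡ (double-+ 1 ν))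
equalized-≤H b∉ c∉ σ _ t≡ (odd ν)                    = f , f∈ , far-family σ f 1 0 1 ν t≡
equalized-≤H c∉ a∉ σ _ t≡ (even 0)                   = d , d∈ , ahead-point σ d 0 2 t≡
equalized-≤H c∉ a∉ σ _ t≡ (even 1)                   = d , d∈ , near-point σ d 1 1 t≡
equalized-≤H c∉ a∉ σ _ t≡ (even (suc (suc ν)))       = f , f∈ , near-family σ f 2 2 ν (trans t≡ (double-+ 2 ν))
equalized-≤H c∉ a∉ σ _ t≡ (odd 0)                    = d , d∈ , ahead-point σ d 1 0 t≡
equalized-≤H c∉ a∉ σ _ t≡ (odd (suc ν))              = f , f∈ , far-family σ f 3 0 0 ν (trans t≡ (cong suc (double-+ 1 ν)))
equalized-≤H c∉ b∉ σ _ t≡ (even 0)                   = f , f∈ , behind-point σ f 0 2 t≡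
equalized-≤H c∉ b∉ σ _ t≡ (even (suc ν))             = f , f∈ , far-family σ f 2 0 1 ν (trans t≡ (double-+ 1 ν))
equalized-≤H c∉ b∉ σ _ t≡ (odd 0)                    = f , f∈ , ahead-point σ f 1 0 t≡
equalized-≤H c∉ b∉ σ _ t≡ (odd (suc ν))              = f , f∈ , near-family σ f 1 2 ν (trans t≡ (cong suc (double-+ 1 ν)))
equalized-≤H c∉ c∉ σ u≢v t≡ (even zero)              = ⊥-elim (u≢v (cong (c ,_) (offset≡0⇒≡ t≡)))
equalized-≤H c∉ c∉ σ _ t≡ (even (suc ν))             = d , d∈ , near-family σ d 1 1 ν (trans t≡ (double-+ 1 ν))
equalized-≤H c∉ c∉ σ _ t≡ (odd ν)                    = e , e∈ , near-family σ e 0 1 ν t≡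

Equalized-sym : {u v : V (suc m)} → Equalized u v → Equalized v u
Equalized-sym (k' , k'∈ , (l , equidistant)) = k' , k'∈ , (l , sym equidistant)

offset-flip : (i j : Fin (suc m)) → 1 ≤ offset i j → offset j i ≡ suc m ∸ offset i j
offset-flip {m} i j 1≤t = offset-compose refl (offset-self i) (∸-monoʳ-< 1≤t (<⇒≤ (offset<n i j)))
  (trans (cong (_% suc m) (m+[n∸m]≡n (<⇒≤ (offset<n i j)))) (n%n≡0 (suc m)))

equalized : ∀ {H k₁ k₂} → Outside k₁ → Outside k₂ → suc m ≡ H + H → 3 ≤ H →
            (i j : Fin (suc m)) → (k₁ , i) ≢ (k₂ , j) → Equalized (k₁ , i) (k₂ , j)
equalized {m} {H} out₁ out₂ size H≥3 i j u≢v with offset i j ≤? H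
... | yes t≤H = equalized-≤H out₁ out₂ (record { size = size ; H≥3 = H≥3 ; offset≤H = t≤H }) u≢v refl (halve _)
... | no t≰H = Equalized-sym
  (equalized-≤H out₂ out₁ (record { size = size ; H≥3 = H≥3 ; offset≤H = flipped≤H }) (u≢v ∘ sym) refl (halve _))
  where
  flipped≤H : offset j i ≤ H
  flipped≤H = begin
    offset j i            ≡⟨ offset-flip i j (≤-trans (s≤s z≤n) (≰⇒> t≰H)) ⟩
    suc m ∸ offset i j    ≤⟨ ∸-monoʳ-≤ (suc m) (<⇒≤ (≰⇒> t≰H)) ⟩
    suc m ∸ H             ≡⟨ cong (_∸ H) size ⟩
    H + H ∸ H             ≡⟨ m+n∸n≡m H H ⟩
    H                     ∎
    where open ≤-Reasoning

equalizerSet : ∀ m → List (V (suc m))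
equalizerSet m = cartesianProduct equalizerRows (allFin (suc m))

length-cartesianProduct : ∀ {A B : Set} (xs : List A) (ys : List B) → length (cartesianProduct xs ys) ≡ length xs * length ys
length-cartesianProduct [] ys = refl
length-cartesianProduct (x ∷ xs) ys = begin
  length (List.map (x ,_) ys List.++ cartesianProduct xs ys)      ≡⟨ length-++ (List.map (x ,_) ys) ⟩
  length (List.map (x ,_) ys) + length (cartesianProduct xs ys)   ≡⟨ cong₂ _+_ (length-map (x ,_) ys)
                                                                                (length-cartesianProduct xs ys) ⟩
  length ys + length xs * length ys                               ∎
  where open ≡-Reasoning

equalizerSet-length : ∀ m → length (equalizerSet m) ≡ 3 * suc m
equalizerSet-length m =
  trans (length-cartesianProduct equalizerRows (allFin (suc m))) (cong (3 *_) (length-tabulate {n = suc m} (λ i → i)))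

equalizerSet-unique : ∀ m → Unique (equalizerSet m)
equalizerSet-unique m = cartesianProduct⁺ (((λ ()) ∷ (λ ()) ∷ []) ∷ ((λ ()) ∷ []) ∷ [] ∷ []) (allFin⁺ (suc m))

∈-equalizerSet : ∀ {k} {i : Fin (suc m)} → k ∈ equalizerRows → (k , i) ∈ equalizerSet m
∈-equalizerSet {m} {i = i} k∈ = ∈-cartesianProduct⁺ {xs = equalizerRows} {ys = allFin (suc m)} k∈ (∈-allFin i)

outside : ∀ {k} {i : Fin (suc m)} → (k , i) ∉ equalizerSet m → Outside k
outside {k = a} _ = a∉
outside {k = b} _ = b∉
outside {k = c} _ = c∉
outside {k = d} ∉S = ⊥-elim (∉S (∈-equalizerSet d∈))
outside {k = e} ∉S = ⊥-elim (∉S (∈-equalizerSet e∈))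
outside {k = f} ∉S = ⊥-elim (∉S (∈-equalizerSet f∈))

equalizerSet-isDistanceEqualizer : ∀ {H} → suc m ≡ H + H → 3 ≤ H → DistanceEqualizer (equalizerSet m)
equalizerSet-isDistanceEqualizer size H≥3 u@(k₁ , i) v@(k₂ , j) u≢v u∉S v∉S
  with equalized (outside u∉S) (outside v∉S) size H≥3 i j u≢v
... | k' , k'∈ , (l , equidistant) =
  (k' , l) , ∈-equalizerSet k'∈ ,
  δ u (k' , l) , δ-isDist u (k' , l) , subst (Dist v (k' , l)) (sym equidistant) (δ-isDist v (k' , l))

mainTheorem2 : (n : ℕ) → 5 ≤ n → 2 ∣ n → EqDim n (3 * n)
mainTheorem2 zero () _
mainTheorem2 (suc m) 5≤n (divides H n≡H*2) =
  (equalizerSet m , equalizerSet-unique m , equalizerSet-length m , equalizerSet-isDistanceEqualizer size H≥3) ,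
  λ S _ isEqualizer → DistanceEqualizer⇒3n≤length S isEqualizer
  where
  size : suc m ≡ H + H
  size = trans n≡H*2 (trans (*-comm H 2) (cong (H +_) (+-identityʳ H)))
  H≥3 : 3 ≤ H
  H≥3 = ≰⇒> λ H≤2 → <⇒≱ (n<1+n 4) (≤-trans (subst (5 ≤_) n≡H*2 5≤n) (*-monoˡ-≤ 2 H≤2))
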